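{- Let $k,d,t$ be positive integers. If the complete graph $K_k$ has a $t$-biclique covering of size $d$, then $k \leq 1+\sum_{s=1}^t 2^{s-1}\binom{d}{s}$.
   Context: A $t$-biclique covering of a graph $G$ is a collection of complete bipartite subgraphs (bicliques) of $G$ such that every edge of $G$ belongs to at least one and at most $t$ of them; its size is the number of bicliques in the collection. -}

module Defs where

open import Data.Nat using (ℕ; zero; suc; _+_; _*_; _^_; _≤_; _∸_)
open import Data.Nat.Combinatorics using (_C_)
open import Data.Bool using (Bool; true; false; _∧_; _∨_; not; if_then_else_)
open import Data.Fin using (Fin)
open import Data.Vec using (Vec; toList)
open import Data.List using (List; filter; length)
open import Data.Product using (_×_; ∃; _,_)
open import Relation.Binary.PropositionalEquality using (_≡_; _≢_)
open import Relation.Nullary.Decidable using (does)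
open import Relation.Unary using (Decidable)

-- A biclique (complete bipartite subgraph) of the complete graph K_k on vertex
-- set Fin k is determined by two disjoint, nonempty vertex sets (the two sides);
-- in K_k every such pair spans a complete bipartite subgraph.
record Biclique (k : ℕ) : Set where
  field
    left     : Fin k → Bool
    right    : Fin k → Bool
    disjoint : ∀ v → left v ∧ right v ≡ false
    leftNonempty  : ∃ λ v → left v ≡ true
    rightNonempty : ∃ λ v → right v ≡ true
open Biclique public

covers : ∀ {k} → Biclique k → Fin k → Fin k → Bool
covers B u v = (left B u ∧ right B v) ∨ (left B v ∧ right B u)

multiplicity : ∀ {k d} → Vec (Biclique k) d → Fin k → Fin k → ℕ
multiplicity {k} 𝓑 u v = length (filter (λ B → covers B u v Data.Bool.≟ true) (toList 𝓑))

IsTBicliqueCovering : (k t d : ℕ) → Vec (Biclique k) d → Set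
IsTBicliqueCovering k t d 𝓑 =
  ∀ (u v : Fin k) → u ≢ v → (1 ≤ multiplicity 𝓑 u v) × (multiplicity 𝓑 u v ≤ t)

HasTBicliqueCovering : (k t d : ℕ) → Set
HasTBicliqueCovering k t d = ∃ λ (𝓑 : Vec (Biclique k) d) → IsTBicliqueCovering k t d 𝓑

bicliqueBoundSum : (d t : ℕ) → ℕ
bicliqueBoundSum d zero    = 0
bicliqueBoundSum d (suc s) = bicliqueBoundSum d s + 2 ^ s * (d C suc s)

-- For a t-biclique covering 𝓑 of K_k the integer matrix S(u,v) = Σ_{s ≤ t} (-1)^s (m(u,v) choose s),
-- with m(u,v) the number of bicliques containing uv, is the identity: m(u,u) = 0, and 1 ≤ m(u,v) ≤ t
-- for u ≠ v. Expanding the binomial coefficients as sums over sets of at most t bicliques writes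
-- S(u,v) as a signed sum of products f(u) g(v) of 0/1 vectors, f choosing a side of each biclique of
-- the set and g the opposite sides. In every term f or g takes the left side of the first biclique of
-- the set, and there are 1 + Σ_{s=1}^t 2^{s-1} (d choose s) such vectors. An integer vector x
-- orthogonal to all of them has Σ_u x_u² = xᵀ S x = 0, so x = 0; as fewer homogeneous linear
-- equations than unknowns always have a nonzero integer solution, k is at most their number.

module Submission where

open import Defs
open import Data.Nat as ℕ using (ℕ; zero; suc; _≤_; _<_; NonZero; s≤s)
import Data.Nat.Properties as ℕP
import Data.Nat.Tactic.RingSolver as ℕ-Solver
open import Data.Nat.Combinatorics using (_C_; nCk+nC[k+1]≡[n+1]C[k+1])
open import Data.Integer as ℤ using (ℤ; 0ℤ; 1ℤ; -1ℤ; _+_; _*_; _-_; -_)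
open import Data.Integer.Properties as ℤP using (+-*-semiring)
open import Data.Integer.Tactic.RingSolver using (solve-∀)
open import Algebra.Properties.Semiring.Sum +-*-semiring
  using (sum; ∑-distrib-+; *-distribˡ-sum; *-distribʳ-sum; sum-cong-≗; sum-remove; sum-replicate-zero)
open import Data.Bool using (Bool; true; false; _∧_; _∨_)
open import Data.Fin using (Fin; zero; suc; punchIn)
open import Data.Fin.Properties using (punchInᵢ≢i)
open import Data.Vec using (Vec; []; _∷_)
open import Data.Vec.Functional using (Vector; head; tail)
open import Data.List using (List; []; _∷_; [_]; _++_; length; map)
open import Data.List.Properties using (length-map; length-++)
open import Data.List.Relation.Unary.All as All using (All; []; _∷_)
open import Data.List.Relation.Unary.All.Properties using (map⁻; ++⁻)
open import Data.List.Relation.Binary.Permutation.Propositional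
  using (_↭_; ↭-refl; ↭-sym; ↭-trans; ↭-prep; ↭-swap)
open import Data.List.Relation.Binary.Permutation.Propositional.Properties using (All-resp-↭; ↭-length)
open import Data.Product using (∃₂; _×_; _,_; proj₁; proj₂)
open import Function using (_∘_; id)
open import Data.Sum using (_⊎_; inj₁; inj₂; [_,_]′)
open import Relation.Nullary using (yes; no; contradiction)
open import Relation.Binary.PropositionalEquality
  using (_≡_; _≢_; refl; sym; trans; cong; cong₂; subst; module ≡-Reasoning)
open ≡-Reasoning

private variable
  n : ℕ

∑-neg : (f : Vector ℤ n) → sum (λ i → - f i) ≡ - sum f
∑-neg f = begin
  sum (λ i → - f i)     ≡⟨ sum-cong-≗ (λ i → sym (ℤP.-1*i≡-i (f i))) ⟩
  sum (λ i → -1ℤ * f i) ≡⟨ *-distribˡ-sum -1ℤ f ⟨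
  -1ℤ * sum f           ≡⟨ ℤP.-1*i≡-i (sum f) ⟩
  - sum f               ∎

∑-distrib-minus : (f g : Vector ℤ n) → sum (λ i → f i - g i) ≡ sum f - sum g
∑-distrib-minus f g = trans (∑-distrib-+ f (λ i → - g i)) (cong (sum f +_) (∑-neg g))

∑-delta : (f : Vector ℤ n) (i : Fin n) → (∀ j → j ≢ i → f j ≡ 0ℤ) → sum f ≡ f i
∑-delta {suc n} f i off = begin
  sum f                                  ≡⟨ sum-remove {i = i} f ⟩
  f i + sum {n} (λ j → f (punchIn i j))  ≡⟨ cong (f i +_) (sum-cong-≗ (off _ ∘ punchInᵢ≢i i)) ⟩
  f i + sum {n} (λ _ → 0ℤ)               ≡⟨ cong (f i +_) (sum-replicate-zero n) ⟩
  f i + 0ℤ                               ≡⟨ ℤP.+-identityʳ (f i) ⟩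
  f i                                    ∎

square-nonneg : (x : ℤ) → 0ℤ ℤ.≤ x * x
square-nonneg (ℤ.+ zero)  = ℤ.+≤+ ℕ.z≤n
square-nonneg (ℤ.+ suc _) = ℤ.+≤+ ℕ.z≤n
square-nonneg ℤ.-[1+ _ ]  = ℤ.+≤+ ℕ.z≤n

nonneg-+≡0 : ∀ {a b} → 0ℤ ℤ.≤ a → 0ℤ ℤ.≤ b → a + b ≡ 0ℤ → a ≡ 0ℤ × b ≡ 0ℤ
nonneg-+≡0 {ℤ.+ m} {ℤ.+ n} _ _ a+b≡0 =
  cong ℤ.+_ (ℕP.m+n≡0⇒m≡0 m (ℤP.+-injective a+b≡0)) ,
  cong ℤ.+_ (ℕP.m+n≡0⇒n≡0 m (ℤP.+-injective a+b≡0))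

∑-nonneg : (f : Vector ℤ n) → (∀ i → 0ℤ ℤ.≤ f i) → 0ℤ ℤ.≤ sum f
∑-nonneg {zero}  f f≥0 = ℤP.≤-refl
∑-nonneg {suc n} f f≥0 = ℤP.+-mono-≤ (f≥0 zero) (∑-nonneg (tail f) (f≥0 ∘ suc))

∑-nonneg-≡0 : (f : Vector ℤ n) → (∀ i → 0ℤ ℤ.≤ f i) → sum f ≡ 0ℤ → ∀ i → f i ≡ 0ℤ
∑-nonneg-≡0 {suc n} f f≥0 ∑f≡0
  with nonneg-+≡0 (f≥0 zero) (∑-nonneg (tail f) (f≥0 ∘ suc)) ∑f≡0
... | f₀≡0 , ∑tail≡0 = λ where
  zero    → f₀≡0
  (suc i) → ∑-nonneg-≡0 (tail f) (f≥0 ∘ suc) ∑tail≡0 i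

_⊙_ : Vector ℤ n → Vector ℤ n → Vector ℤ n
(f ⊙ g) i = f i * g i

⟨_,_⟩ : Vector ℤ n → Vector ℤ n → ℤ
⟨ f , x ⟩ = sum (f ⊙ x)

_⊥_ : Vector ℤ n → List (Vector ℤ n) → Set
x ⊥ fs = All (λ f → ⟨ f , x ⟩ ≡ 0ℤ) fs

ones : Vector ℤ n
ones _ = 1ℤ

⟨ones,⟩ : (x : Vector ℤ n) → ⟨ ones , x ⟩ ≡ sum x
⟨ones,⟩ x = sum-cong-≗ (λ i → ℤP.*-identityˡ (x i))

⟨⊙,⟩ : (w f x : Vector ℤ n) → ⟨ w ⊙ f , x ⟩ ≡ ⟨ f , w ⊙ x ⟩
⟨⊙,⟩ w f x = sum-cong-≗ (λ i → regroup (w i) (f i) (x i))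
  where
  regroup : ∀ a b c → a * b * c ≡ b * (a * c)
  regroup = solve-∀

⊥-map-⊙ : (w x : Vector ℤ n) (fs : List (Vector ℤ n)) → x ⊥ map (w ⊙_) fs → (w ⊙ x) ⊥ fs
⊥-map-⊙ w x fs x⊥ = All.map (λ {f} → trans (sym (⟨⊙,⟩ w f x))) (map⁻ x⊥)

∑-squares≡0 : (x : Vector ℤ n) → sum (x ⊙ x) ≡ 0ℤ → ∀ i → x i ≡ 0ℤ
∑-squares≡0 x ∑x²≡0 i =
  [ id , id ]′ (ℤP.i*j≡0⇒i≡0∨j≡0 (x i) (∑-nonneg-≡0 (x ⊙ x) (λ j → square-nonneg (x j)) ∑x²≡0 i))

i*j≢0 : ∀ {i j : ℤ} → i ≢ 0ℤ → j ≢ 0ℤ → i * j ≢ 0ℤ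
i*j≢0 {i} i≢0 j≢0 ij≡0 = [ i≢0 , j≢0 ]′ (ℤP.i*j≡0⇒i≡0∨j≡0 i ij≡0)

heads-vanish⊎pivot : (fs : List (Vector ℤ (suc n))) →
  All (λ f → head f ≡ 0ℤ) fs ⊎ ∃₂ λ f rest → head f ≢ 0ℤ × fs ↭ f ∷ rest
heads-vanish⊎pivot [] = inj₁ []
heads-vanish⊎pivot (f ∷ fs) with head f ℤ.≟ 0ℤ
... | no f₀≢0 = inj₂ (f , fs , f₀≢0 , ↭-refl)
... | yes f₀≡0 with heads-vanish⊎pivot fs
...   | inj₁ heads≡0 = inj₁ (f₀≡0 ∷ heads≡0)
...   | inj₂ (g , rest , g₀≢0 , fs↭) =
  inj₂ (g , f ∷ rest , g₀≢0 , ↭-trans (↭-prep f fs↭) (↭-swap f g ↭-refl))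

e₀ : Vector ℤ (suc n)
e₀ zero    = 1ℤ
e₀ (suc _) = 0ℤ

⟨,e₀⟩≡0 : {f : Vector ℤ (suc n)} → head f ≡ 0ℤ → ⟨ f , e₀ ⟩ ≡ 0ℤ
⟨,e₀⟩≡0 {f = f} f₀≡0 = begin
  ⟨ f , e₀ ⟩  ≡⟨ ∑-delta (f ⊙ e₀) zero off-zero ⟩
  head f * 1ℤ ≡⟨ ℤP.*-identityʳ (head f) ⟩
  head f      ≡⟨ f₀≡0 ⟩
  0ℤ          ∎
  where
  off-zero : ∀ j → j ≢ zero → (f ⊙ e₀) j ≡ 0ℤ
  off-zero zero    j≢0 = contradiction refl j≢0
  off-zero (suc j) _   = ℤP.*-zeroʳ (f (suc j))

-- Gaussian elimination of the first unknown with pivot row f: a solution y of the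
-- eliminated rows extends to a solution of all rows.
eliminate : Vector ℤ (suc n) → Vector ℤ (suc n) → Vector ℤ n
eliminate f g i = head f * g (suc i) - head g * f (suc i)

extend : Vector ℤ (suc n) → Vector ℤ n → Vector ℤ (suc n)
extend f y zero    = - ⟨ tail f , y ⟩
extend f y (suc i) = head f * y i

⟨,extend⟩ : (f g : Vector ℤ (suc n)) (y : Vector ℤ n) →
  ⟨ g , extend f y ⟩ ≡ head f * ⟨ tail g , y ⟩ - head g * ⟨ tail f , y ⟩
⟨,extend⟩ f g y = begin
  head g * (- D) + sum (λ i → g (suc i) * (head f * y i))
    ≡⟨ cong (head g * (- D) +_) (sum-cong-≗ (λ i → swap-factors (g (suc i)) (head f) (y i))) ⟩
  head g * (- D) + sum (λ i → head f * (g (suc i) * y i))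
    ≡⟨ cong (head g * (- D) +_) (*-distribˡ-sum (head f) (tail g ⊙ y)) ⟨
  head g * (- D) + head f * E
    ≡⟨ rearrange (head g) D (head f) E ⟩
  head f * E - head g * D ∎
  where
  D = ⟨ tail f , y ⟩
  E = ⟨ tail g , y ⟩
  swap-factors : ∀ a b c → a * (b * c) ≡ b * (a * c)
  swap-factors = solve-∀
  rearrange : ∀ a b c d → a * (- b) + c * d ≡ c * d - a * b
  rearrange = solve-∀

⟨eliminate,⟩ : (f g : Vector ℤ (suc n)) (y : Vector ℤ n) →
  ⟨ eliminate f g , y ⟩ ≡ head f * ⟨ tail g , y ⟩ - head g * ⟨ tail f , y ⟩
⟨eliminate,⟩ f g y = begin
  sum (λ i → (head f * g (suc i) - head g * f (suc i)) * y i)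
    ≡⟨ sum-cong-≗ (λ i → distrib (head f) (g (suc i)) (head g) (f (suc i)) (y i)) ⟩
  sum (λ i → head f * (g (suc i) * y i) - head g * (f (suc i) * y i))
    ≡⟨ ∑-distrib-minus (λ i → head f * (g (suc i) * y i)) (λ i → head g * (f (suc i) * y i)) ⟩
  sum (λ i → head f * (g (suc i) * y i)) - sum (λ i → head g * (f (suc i) * y i))
    ≡⟨ cong₂ _-_ (*-distribˡ-sum (head f) (tail g ⊙ y)) (*-distribˡ-sum (head g) (tail f ⊙ y)) ⟨
  head f * E - head g * D ∎
  where
  D = ⟨ tail f , y ⟩
  E = ⟨ tail g , y ⟩
  distrib : ∀ a b c d e → (a * b - c * d) * e ≡ a * (b * e) - c * (d * e)
  distrib = solve-∀

⟨,extend⟩≡⟨eliminate,⟩ : (f g : Vector ℤ (suc n)) (y : Vector ℤ n) →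
  ⟨ g , extend f y ⟩ ≡ ⟨ eliminate f g , y ⟩
⟨,extend⟩≡⟨eliminate,⟩ f g y = trans (⟨,extend⟩ f g y) (sym (⟨eliminate,⟩ f g y))

⟨,extend-self⟩ : (f : Vector ℤ (suc n)) (y : Vector ℤ n) → ⟨ f , extend f y ⟩ ≡ 0ℤ
⟨,extend-self⟩ f y = trans (⟨,extend⟩ f f y) (ℤP.+-inverseʳ (head f * ⟨ tail f , y ⟩))

nonzero-solution : ∀ n (fs : List (Vector ℤ n)) → length fs < n →
  ∃₂ λ (x : Vector ℤ n) i → x i ≢ 0ℤ × x ⊥ fs
nonzero-solution (suc n) fs fs<n with heads-vanish⊎pivot fs
... | inj₁ heads≡0 = e₀ , zero , (λ ()) , All.map (λ {f} → ⟨,e₀⟩≡0 {f = f}) heads≡0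
... | inj₂ (f , rest , f₀≢0 , fs↭) with nonzero-solution n (map (eliminate f) rest) rest<n
  where
  rest<n : length (map (eliminate f) rest) < n
  rest<n = subst (_< n) (sym (length-map (eliminate f) rest))
                 (ℕP.≤-pred (subst (_< suc n) (↭-length fs↭) fs<n))
...   | y , j , yⱼ≢0 , y⊥ =
  extend f y , suc j , i*j≢0 f₀≢0 yⱼ≢0 ,
  All-resp-↭ (↭-sym fs↭)
    (⟨,extend-self⟩ f y ∷ All.map (λ {g} → trans (⟨,extend⟩≡⟨eliminate,⟩ f g y)) (map⁻ y⊥))

bilinear : (Fin n → Fin n → ℤ) → Vector ℤ n → Vector ℤ n → ℤ
bilinear M α β = sum (λ u → sum (λ v → α u * β v * M u v))

bilinear-cong : {M N : Fin n → Fin n → ℤ} (α β : Vector ℤ n) →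
  (∀ u v → M u v ≡ N u v) → bilinear M α β ≡ bilinear N α β
bilinear-cong α β M≡N = sum-cong-≗ (λ u → sum-cong-≗ (λ v → cong (α u * β v *_) (M≡N u v)))

bilinear-one : (α β : Vector ℤ n) → bilinear (λ _ _ → 1ℤ) α β ≡ sum α * sum β
bilinear-one α β = begin
  sum (λ u → sum (λ v → α u * β v * 1ℤ))
    ≡⟨ sum-cong-≗ (λ u → sum-cong-≗ (λ v → ℤP.*-identityʳ (α u * β v))) ⟩
  sum (λ u → sum (λ v → α u * β v))
    ≡⟨ sum-cong-≗ (λ u → *-distribˡ-sum (α u) β) ⟨
  sum (λ u → α u * sum β)
    ≡⟨ *-distribʳ-sum (sum β) α ⟨
  sum α * sum β ∎

bilinear-one-vanishesˡ : (α β : Vector ℤ n) → ⟨ ones , α ⟩ ≡ 0ℤ → bilinear (λ _ _ → 1ℤ) α β ≡ 0ℤ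
bilinear-one-vanishesˡ α β α⊥1 = trans (bilinear-one α β) (cong (_* sum β) (trans (sym (⟨ones,⟩ α)) α⊥1))

bilinear-one-vanishesʳ : (α β : Vector ℤ n) → ⟨ ones , β ⟩ ≡ 0ℤ → bilinear (λ _ _ → 1ℤ) α β ≡ 0ℤ
bilinear-one-vanishesʳ α β β⊥1 = begin
  bilinear (λ _ _ → 1ℤ) α β ≡⟨ bilinear-one α β ⟩
  sum α * sum β             ≡⟨ cong (sum α *_) (trans (sym (⟨ones,⟩ β)) β⊥1) ⟩
  sum α * 0ℤ                ≡⟨ ℤP.*-zeroʳ (sum α) ⟩
  0ℤ                        ∎

bilinear-+ : (M N : Fin n → Fin n → ℤ) (α β : Vector ℤ n) →
  bilinear (λ u v → M u v + N u v) α β ≡ bilinear M α β + bilinear N α β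
bilinear-+ M N α β = begin
  sum (λ u → sum (λ v → α u * β v * (M u v + N u v)))
    ≡⟨ sum-cong-≗ (λ u → sum-cong-≗ (λ v → ℤP.*-distribˡ-+ (α u * β v) (M u v) (N u v))) ⟩
  sum (λ u → sum (λ v → α u * β v * M u v + α u * β v * N u v))
    ≡⟨ sum-cong-≗ (λ u → ∑-distrib-+ (λ v → α u * β v * M u v) (λ v → α u * β v * N u v)) ⟩
  sum (λ u → sum (λ v → α u * β v * M u v) + sum (λ v → α u * β v * N u v))
    ≡⟨ ∑-distrib-+ (λ u → sum (λ v → α u * β v * M u v)) (λ u → sum (λ v → α u * β v * N u v)) ⟩
  bilinear M α β + bilinear N α β ∎

bilinear-minus : (M N : Fin n → Fin n → ℤ) (α β : Vector ℤ n) →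
  bilinear (λ u v → M u v - N u v) α β ≡ bilinear M α β - bilinear N α β
bilinear-minus M N α β = begin
  sum (λ u → sum (λ v → α u * β v * (M u v - N u v)))
    ≡⟨ sum-cong-≗ (λ u → sum-cong-≗ (λ v → distrib (α u * β v) (M u v) (N u v))) ⟩
  sum (λ u → sum (λ v → α u * β v * M u v - α u * β v * N u v))
    ≡⟨ sum-cong-≗ (λ u → ∑-distrib-minus (λ v → α u * β v * M u v) (λ v → α u * β v * N u v)) ⟩
  sum (λ u → sum (λ v → α u * β v * M u v) - sum (λ v → α u * β v * N u v))
    ≡⟨ ∑-distrib-minus (λ u → sum (λ v → α u * β v * M u v)) (λ u → sum (λ v → α u * β v * N u v)) ⟩
  bilinear M α β - bilinear N α β ∎
  where
  distrib : ∀ a b c → a * (b - c) ≡ a * b - a * c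
  distrib = solve-∀

bilinear-rank-one-* : (p q : Vector ℤ n) (M : Fin n → Fin n → ℤ) (α β : Vector ℤ n) →
  bilinear (λ u v → p u * q v * M u v) α β ≡ bilinear M (p ⊙ α) (q ⊙ β)
bilinear-rank-one-* p q M α β =
  sum-cong-≗ (λ u → sum-cong-≗ (λ v → regroup (α u) (β v) (p u) (q v) (M u v)))
  where
  regroup : ∀ a b c d e → a * b * (c * d * e) ≡ c * a * (d * b) * e
  regroup = solve-∀

bilinear-diagonal : (M : Fin n → Fin n → ℤ) (x : Vector ℤ n) →
  (∀ u → M u u ≡ 1ℤ) → (∀ u v → u ≢ v → M u v ≡ 0ℤ) → bilinear M x x ≡ sum (x ⊙ x)
bilinear-diagonal M x diagonal off-diagonal = sum-cong-≗ row
  where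
  row : ∀ u → sum (λ v → x u * x v * M u v) ≡ x u * x u
  row u = begin
    sum (λ v → x u * x v * M u v) ≡⟨ ∑-delta _ u (λ v v≢u → vanishes v (v≢u ∘ sym)) ⟩
    x u * x u * M u u             ≡⟨ cong (x u * x u *_) (diagonal u) ⟩
    x u * x u * 1ℤ                ≡⟨ ℤP.*-identityʳ (x u * x u) ⟩
    x u * x u                     ∎
    where
    vanishes : ∀ v → u ≢ v → x u * x v * M u v ≡ 0ℤ
    vanishes v u≢v = trans (cong (x u * x v *_) (off-diagonal u v u≢v)) (ℤP.*-zeroʳ (x u * x v))

bicliqueBoundSum-zeroˡ : ∀ t → bicliqueBoundSum 0 t ≡ 0
bicliqueBoundSum-zeroˡ zero    = refl
bicliqueBoundSum-zeroˡ (suc t) = cong₂ ℕ._+_ (bicliqueBoundSum-zeroˡ t) (ℕP.*-zeroʳ (2 ℕ.^ t))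

bicliqueBoundSum-suc : ∀ n t →
  bicliqueBoundSum (suc n) (suc t) ≡ bicliqueBoundSum n (suc t) ℕ.+ suc (2 ℕ.* bicliqueBoundSum n t)
bicliqueBoundSum-suc n zero
  rewrite sym (nCk+nC[k+1]≡[n+1]C[k+1] n 0) = base (n C 1)
  where
  base : ∀ a → 1 ℕ.* (1 ℕ.+ a) ≡ 1 ℕ.* a ℕ.+ 1
  base = ℕ-Solver.solve-∀
bicliqueBoundSum-suc n (suc t)
  rewrite bicliqueBoundSum-suc n t | sym (nCk+nC[k+1]≡[n+1]C[k+1] n (suc t)) =
  step (bicliqueBoundSum n (suc t)) (bicliqueBoundSum n t) (2 ℕ.^ t) (n C suc t) (n C suc (suc t))
  where
  step : ∀ a b p c₁ c₂ →
    a ℕ.+ suc (2 ℕ.* b) ℕ.+ 2 ℕ.* p ℕ.* (c₁ ℕ.+ c₂) ≡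
    a ℕ.+ 2 ℕ.* p ℕ.* c₂ ℕ.+ suc (2 ℕ.* (b ℕ.+ p ℕ.* c₁))
  step = ℕ-Solver.solve-∀

-- alternatingBinomialSum m t = Σ_{s ≤ t} (-1)^s (m choose s), computed by Pascal's rule.
alternatingBinomialSum : ℕ → ℕ → ℤ
alternatingBinomialSum zero    t       = 1ℤ
alternatingBinomialSum (suc m) zero    = 1ℤ
alternatingBinomialSum (suc m) (suc t) = alternatingBinomialSum m (suc t) - alternatingBinomialSum m t

alternatingBinomialSum-zeroʳ : ∀ m → alternatingBinomialSum m zero ≡ 1ℤ
alternatingBinomialSum-zeroʳ zero    = refl
alternatingBinomialSum-zeroʳ (suc m) = refl

alternatingBinomialSum-vanishes : ∀ m t → 1 ≤ m → m ≤ t → alternatingBinomialSum m t ≡ 0ℤ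
alternatingBinomialSum-vanishes (suc zero)    (suc t) _ _ = refl
alternatingBinomialSum-vanishes (suc (suc m)) (suc t) _ (s≤s m<t)
  rewrite alternatingBinomialSum-vanishes (suc m) (suc t) (s≤s ℕ.z≤n) (ℕP.m≤n⇒m≤1+n m<t)
        | alternatingBinomialSum-vanishes (suc m) t (s≤s ℕ.z≤n) m<t = refl

indicator : Bool → ℤ
indicator true  = 1ℤ
indicator false = 0ℤ

indicator-∨-∧ : ∀ lu ru lv rv → lu ∧ ru ≡ false → lv ∧ rv ≡ false →
  indicator lu * indicator rv + indicator ru * indicator lv ≡ indicator ((lu ∧ rv) ∨ (lv ∧ ru))
indicator-∨-∧ true  true  _     _     ()   _
indicator-∨-∧ _     _     true  true  _    ()
indicator-∨-∧ true  false true  false _    _ = refl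
indicator-∨-∧ true  false false true  _    _ = refl
indicator-∨-∧ true  false false false _    _ = refl
indicator-∨-∧ false true  true  false _    _ = refl
indicator-∨-∧ false true  false true  _    _ = refl
indicator-∨-∧ false true  false false _    _ = refl
indicator-∨-∧ false false true  false _    _ = refl
indicator-∨-∧ false false false true  _    _ = refl
indicator-∨-∧ false false false false _    _ = refl

module _ {k : ℕ} where

  inLeft inRight : Biclique k → Vector ℤ k
  inLeft  c u = indicator (left c u)
  inRight c u = indicator (right c u)

  coverIndicator : Biclique k → Fin k → Fin k → ℤ
  coverIndicator c u v = inLeft c u * inRight c v + inRight c u * inLeft c v

  coverIndicator≡indicator-covers : ∀ c u v → coverIndicator c u v ≡ indicator (covers c u v)
  coverIndicator≡indicator-covers c u v =
    indicator-∨-∧ (left c u) (right c u) (left c v) (right c v) (disjoint c u) (disjoint c v)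

  -- sieve cs t u v = Σ (-1)^|S| Π_{c ∈ S} coverIndicator c u v over the S ⊆ cs with |S| ≤ t.
  sieve : Vec (Biclique k) n → ℕ → Fin k → Fin k → ℤ
  sieve []       t       u v = 1ℤ
  sieve (c ∷ cs) zero    u v = 1ℤ
  sieve (c ∷ cs) (suc t) u v = sieve cs (suc t) u v - coverIndicator c u v * sieve cs t u v

  sieve≡alternatingBinomialSum : ∀ (cs : Vec (Biclique k) n) t u v →
    sieve cs t u v ≡ alternatingBinomialSum (multiplicity cs u v) t
  sieve≡alternatingBinomialSum []       t       u v = refl
  sieve≡alternatingBinomialSum (c ∷ cs) zero    u v =
    sym (alternatingBinomialSum-zeroʳ (multiplicity (c ∷ cs) u v))
  sieve≡alternatingBinomialSum (c ∷ cs) (suc t) u v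
    rewrite sieve≡alternatingBinomialSum cs (suc t) u v
          | sieve≡alternatingBinomialSum cs t u v
          | coverIndicator≡indicator-covers c u v
    with covers c u v
  ... | true  = cong (_-_ (alternatingBinomialSum (multiplicity cs u v) (suc t)))
                     (ℤP.*-identityˡ (alternatingBinomialSum (multiplicity cs u v) t))
  ... | false = ℤP.+-identityʳ (alternatingBinomialSum (multiplicity cs u v) (suc t))

  multiplicity-diagonal : (cs : Vec (Biclique k) n) (u : Fin k) → multiplicity cs u u ≡ 0
  multiplicity-diagonal []       u = refl
  multiplicity-diagonal (c ∷ cs) u rewrite disjoint c u = multiplicity-diagonal cs u

  sieve-diagonal : ∀ (cs : Vec (Biclique k) n) t u → sieve cs t u u ≡ 1ℤ
  sieve-diagonal cs t u =
    trans (sieve≡alternatingBinomialSum cs t u u)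
          (cong (λ m → alternatingBinomialSum m t) (multiplicity-diagonal cs u))

  sieve-off-diagonal : ∀ {t} (cs : Vec (Biclique k) n) → IsTBicliqueCovering k t n cs →
    ∀ u v → u ≢ v → sieve cs t u v ≡ 0ℤ
  sieve-off-diagonal {t = t} cs covering u v u≢v =
    trans (sieve≡alternatingBinomialSum cs t u v)
          (alternatingBinomialSum-vanishes (multiplicity cs u v) t 1≤m m≤t)
    where
    1≤m = proj₁ (covering u v u≢v)
    m≤t = proj₂ (covering u v u≢v)

  -- Multiplying out the products in sieve cs t u v gives a signed sum of terms m u * m′ v, where m
  -- picks one side of each biclique of S (a monomial in this list) and m′ the opposite sides.
  monomials : Vec (Biclique k) n → ℕ → List (Vector ℤ k)
  monomials []       t       = [ ones ]
  monomials (c ∷ cs) zero    = [ ones ]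
  monomials (c ∷ cs) (suc t) =
    monomials cs (suc t) ++ map (inLeft c ⊙_) (monomials cs t) ++ map (inRight c ⊙_) (monomials cs t)

  -- Of m and m′ exactly one picks the left side of the first biclique of S (both are ones if S = ∅),
  -- so every term of the quadratic form of sieve cs t has a representative as a factor.
  representatives : Vec (Biclique k) n → ℕ → List (Vector ℤ k)
  representatives []       t       = [ ones ]
  representatives (c ∷ cs) zero    = [ ones ]
  representatives (c ∷ cs) (suc t) = representatives cs (suc t) ++ map (inLeft c ⊙_) (monomials cs t)

  bilinear-sieve-suc : ∀ c (cs : Vec (Biclique k) n) t (α β : Vector ℤ k) →
    bilinear (sieve (c ∷ cs) (suc t)) α β ≡
    bilinear (sieve cs (suc t)) α β - (bilinear (sieve cs t) (inLeft c ⊙ α) (inRight c ⊙ β) +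
                                       bilinear (sieve cs t) (inRight c ⊙ α) (inLeft c ⊙ β))
  bilinear-sieve-suc c cs t α β = begin
    bilinear (λ u v → sieve cs (suc t) u v - coverIndicator c u v * S u v) α β
      ≡⟨ bilinear-minus (sieve cs (suc t)) (λ u v → coverIndicator c u v * S u v) α β ⟩
    bilinear (sieve cs (suc t)) α β - bilinear (λ u v → coverIndicator c u v * S u v) α β
      ≡⟨ cong (_-_ (bilinear (sieve cs (suc t)) α β)) expand ⟩
    bilinear (sieve cs (suc t)) α β - (bilinear S (inLeft c ⊙ α) (inRight c ⊙ β) +
                                       bilinear S (inRight c ⊙ α) (inLeft c ⊙ β)) ∎
    where
    S = sieve cs t
    expand : bilinear (λ u v → coverIndicator c u v * S u v) α β ≡
             bilinear S (inLeft c ⊙ α) (inRight c ⊙ β) + bilinear S (inRight c ⊙ α) (inLeft c ⊙ β)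
    expand = begin
      bilinear (λ u v → coverIndicator c u v * S u v) α β
        ≡⟨ bilinear-cong α β (λ u v →
             ℤP.*-distribʳ-+ (S u v) (inLeft c u * inRight c v) (inRight c u * inLeft c v)) ⟩
      bilinear (λ u v → inLeft c u * inRight c v * S u v + inRight c u * inLeft c v * S u v) α β
        ≡⟨ bilinear-+ (λ u v → inLeft c u * inRight c v * S u v)
                      (λ u v → inRight c u * inLeft c v * S u v) α β ⟩
      bilinear (λ u v → inLeft c u * inRight c v * S u v) α β +
      bilinear (λ u v → inRight c u * inLeft c v * S u v) α β
        ≡⟨ cong₂ _+_ (bilinear-rank-one-* (inLeft c) (inRight c) S α β)
                     (bilinear-rank-one-* (inRight c) (inLeft c) S α β) ⟩
      bilinear S (inLeft c ⊙ α) (inRight c ⊙ β) + bilinear S (inRight c ⊙ α) (inLeft c ⊙ β) ∎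

  bilinear-sieve-vanishesˡ : ∀ (cs : Vec (Biclique k) n) t (α β : Vector ℤ k) →
    α ⊥ monomials cs t → bilinear (sieve cs t) α β ≡ 0ℤ
  bilinear-sieve-vanishesˡ []       t       α β (α⊥1 ∷ []) = bilinear-one-vanishesˡ α β α⊥1
  bilinear-sieve-vanishesˡ (c ∷ cs) zero    α β (α⊥1 ∷ []) = bilinear-one-vanishesˡ α β α⊥1
  bilinear-sieve-vanishesˡ (c ∷ cs) (suc t) α β α⊥ with ++⁻ (monomials cs (suc t)) α⊥
  ... | α⊥₁ , α⊥₂₃ with ++⁻ (map (inLeft c ⊙_) (monomials cs t)) α⊥₂₃
  ... | α⊥₂ , α⊥₃ =
    trans (bilinear-sieve-suc c cs t α β)
          (cong₂ _-_ (bilinear-sieve-vanishesˡ cs (suc t) α β α⊥₁)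
                     (cong₂ _+_ (bilinear-sieve-vanishesˡ cs t (inLeft c ⊙ α) (inRight c ⊙ β)
                                                          (⊥-map-⊙ (inLeft c) α _ α⊥₂))
                                (bilinear-sieve-vanishesˡ cs t (inRight c ⊙ α) (inLeft c ⊙ β)
                                                          (⊥-map-⊙ (inRight c) α _ α⊥₃))))

  bilinear-sieve-vanishesʳ : ∀ (cs : Vec (Biclique k) n) t (α β : Vector ℤ k) →
    β ⊥ monomials cs t → bilinear (sieve cs t) α β ≡ 0ℤ
  bilinear-sieve-vanishesʳ []       t       α β (β⊥1 ∷ []) = bilinear-one-vanishesʳ α β β⊥1
  bilinear-sieve-vanishesʳ (c ∷ cs) zero    α β (β⊥1 ∷ []) = bilinear-one-vanishesʳ α β β⊥1
  bilinear-sieve-vanishesʳ (c ∷ cs) (suc t) α β β⊥ with ++⁻ (monomials cs (suc t)) β⊥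
  ... | β⊥₁ , β⊥₂₃ with ++⁻ (map (inLeft c ⊙_) (monomials cs t)) β⊥₂₃
  ... | β⊥₂ , β⊥₃ =
    trans (bilinear-sieve-suc c cs t α β)
          (cong₂ _-_ (bilinear-sieve-vanishesʳ cs (suc t) α β β⊥₁)
                     (cong₂ _+_ (bilinear-sieve-vanishesʳ cs t (inLeft c ⊙ α) (inRight c ⊙ β)
                                                          (⊥-map-⊙ (inRight c) β _ β⊥₃))
                                (bilinear-sieve-vanishesʳ cs t (inRight c ⊙ α) (inLeft c ⊙ β)
                                                          (⊥-map-⊙ (inLeft c) β _ β⊥₂))))

  bilinear-sieve-self-vanishes : ∀ (cs : Vec (Biclique k) n) t (x : Vector ℤ k) →
    x ⊥ representatives cs t → bilinear (sieve cs t) x x ≡ 0ℤ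
  bilinear-sieve-self-vanishes []       t       x (x⊥1 ∷ []) = bilinear-one-vanishesˡ x x x⊥1
  bilinear-sieve-self-vanishes (c ∷ cs) zero    x (x⊥1 ∷ []) = bilinear-one-vanishesˡ x x x⊥1
  bilinear-sieve-self-vanishes (c ∷ cs) (suc t) x x⊥ with ++⁻ (representatives cs (suc t)) x⊥
  ... | x⊥₁ , x⊥₂ =
    trans (bilinear-sieve-suc c cs t x x)
          (cong₂ _-_ (bilinear-sieve-self-vanishes cs (suc t) x x⊥₁)
                     (cong₂ _+_ (bilinear-sieve-vanishesˡ cs t (inLeft c ⊙ x) (inRight c ⊙ x) Lx⊥)
                                (bilinear-sieve-vanishesʳ cs t (inRight c ⊙ x) (inLeft c ⊙ x) Lx⊥)))
    where
    Lx⊥ : (inLeft c ⊙ x) ⊥ monomials cs t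
    Lx⊥ = ⊥-map-⊙ (inLeft c) x (monomials cs t) x⊥₂

  length-monomials : ∀ (cs : Vec (Biclique k) n) t →
    length (monomials cs t) ≡ suc (2 ℕ.* bicliqueBoundSum n t)
  length-monomials []       t    = cong (λ b → suc (2 ℕ.* b)) (sym (bicliqueBoundSum-zeroˡ t))
  length-monomials (c ∷ cs) zero = refl
  length-monomials {suc n} (c ∷ cs) (suc t)
    rewrite length-++ (monomials cs (suc t))
                      {map (inLeft c ⊙_) (monomials cs t) ++ map (inRight c ⊙_) (monomials cs t)}
          | length-++ (map (inLeft c ⊙_) (monomials cs t)) {map (inRight c ⊙_) (monomials cs t)}
          | length-map (inLeft c ⊙_) (monomials cs t) | length-map (inRight c ⊙_) (monomials cs t)
          | length-monomials cs (suc t) | length-monomials cs t | bicliqueBoundSum-suc n t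
    = count (bicliqueBoundSum n (suc t)) (bicliqueBoundSum n t)
    where
    count : ∀ a b →
      suc (2 ℕ.* a) ℕ.+ (suc (2 ℕ.* b) ℕ.+ suc (2 ℕ.* b)) ≡ suc (2 ℕ.* (a ℕ.+ suc (2 ℕ.* b)))
    count = ℕ-Solver.solve-∀

  length-representatives : ∀ (cs : Vec (Biclique k) n) t →
    length (representatives cs t) ≡ suc (bicliqueBoundSum n t)
  length-representatives []       t    = cong suc (sym (bicliqueBoundSum-zeroˡ t))
  length-representatives (c ∷ cs) zero = refl
  length-representatives {suc n} (c ∷ cs) (suc t)
    rewrite length-++ (representatives cs (suc t)) {map (inLeft c ⊙_) (monomials cs t)}
          | length-map (inLeft c ⊙_) (monomials cs t)
          | length-representatives cs (suc t) | length-monomials cs t | bicliqueBoundSum-suc n t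
    = refl

  ⊥-representatives⇒≡0 : ∀ {t} (𝓑 : Vec (Biclique k) n) → IsTBicliqueCovering k t n 𝓑 →
    (x : Vector ℤ k) → x ⊥ representatives 𝓑 t → ∀ u → x u ≡ 0ℤ
  ⊥-representatives⇒≡0 {t = t} 𝓑 covering x x⊥ = ∑-squares≡0 x (begin
    sum (x ⊙ x)
      ≡⟨ bilinear-diagonal (sieve 𝓑 t) x (sieve-diagonal 𝓑 t) (sieve-off-diagonal 𝓑 covering) ⟨
    bilinear (sieve 𝓑 t) x x
      ≡⟨ bilinear-sieve-self-vanishes 𝓑 t x x⊥ ⟩
    0ℤ ∎)

  vertices≤representatives : ∀ {t} (𝓑 : Vec (Biclique k) n) → IsTBicliqueCovering k t n 𝓑 →
    k ≤ length (representatives 𝓑 t)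
  vertices≤representatives {t = t} 𝓑 covering = ℕP.≮⇒≥ λ representatives<k →
    let x , u , xᵤ≢0 , x⊥ = nonzero-solution k (representatives 𝓑 t) representatives<k
    in  xᵤ≢0 (⊥-representatives⇒≡0 𝓑 covering x x⊥ u)

proposition3p1 : (k d t : ℕ) → .{{_ : NonZero k}} → .{{_ : NonZero d}} → .{{_ : NonZero t}} →
    HasTBicliqueCovering k t d → k ≤ 1 ℕ.+ bicliqueBoundSum d t
proposition3p1 k d t (𝓑 , covering) =
  subst (k ≤_) (length-representatives 𝓑 t) (vertices≤representatives 𝓑 covering)
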